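{- For every $N\ge1$ and every cyclic sentence $S$ of length $N$ in the letters $\{A,X,B\}$, one has $|S|=|\overline S|$, where $\overline S$ is the cyclic sentence obtained by reversing $S$.
   Context: A cyclic sentence of length $N$ is a string of length $N$ in the letters $A,X,B$ considered up to cyclic permutation (its letters sit at $N$ positions around a circle). The following words are assigned a coefficient and a weight: $X$ (coefficient $1$, weight $0$); $XA$ ($1$, $1$); $XAA$ ($1$, $1$); $XBA$ ($1$, $1$); $AXA$ ($2$, $1$); $AAA$ ($-1$, $1$); $BA$ ($-1$, $1$); $ABA$ ($-1$, $1$); $XXA$ ($-2$, $1$). A parsing of a cyclic sentence is a decomposition of the cyclic string (cut at some positions around the circle) into consecutive blocks each of which is one of these words. The coefficient of a parsing is the product of the coefficients of its words and its weight is the sum of their weights. $c(S,w)$ is the sum of the coefficients of all parsings of $S$ of weight $w$, and $|S|=\sum_{w\ge0}c(S,w)t^w$, a polynomial in $t$. For example, $(ABAXA)$ has exactly the parsings $ABA/XA$ and $XAA/BA$ (cyclically), so $|(ABAXA)|=-2t^2$. -}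

module Defs where

open import Data.Nat using (ℕ; zero; suc; _≡ᵇ_)
import Data.Nat as ℕ
open import Data.Integer using (ℤ; +_; -_; _*_; _+_)
open import Data.Bool using (Bool; true; false; not; if_then_else_; _∨_)
open import Data.List using (List; []; _∷_; _++_; map; zip; concatMap; foldr)
open import Data.Maybe using (Maybe; just; nothing)
open import Data.Product using (_×_; _,_; proj₂)
open import Data.Vec using (Vec; toList)

data Letter : Set where
  A X B : Letter

-- The dictionary: a word is mapped to just (coefficient , weight),
-- and anything that is not one of the nine words is mapped to nothing.
dict : List Letter → Maybe (ℤ × ℕ)
dict (X ∷ [])         = just (+ 1 , 0)
dict (X ∷ A ∷ [])     = just (+ 1 , 1)
dict (X ∷ A ∷ A ∷ []) = just (+ 1 , 1)
dict (X ∷ B ∷ A ∷ []) = just (+ 1 , 1)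
dict (A ∷ X ∷ A ∷ []) = just (+ 2 , 1)
dict (A ∷ A ∷ A ∷ []) = just (- (+ 1) , 1)
dict (B ∷ A ∷ [])     = just (- (+ 1) , 1)
dict (A ∷ B ∷ A ∷ []) = just (- (+ 1) , 1)
dict (X ∷ X ∷ A ∷ []) = just (- (+ 2) , 1)
dict _                = nothing

-- A cut pattern: for each position i of the circle, a Bool saying whether
-- the circle is cut immediately before position i.
-- All cut patterns of length n.
cutPatterns : ℕ → List (List Bool)
cutPatterns zero    = [] ∷ []
cutPatterns (suc n) = concatMap (λ bs → (true ∷ bs) ∷ (false ∷ bs) ∷ []) (cutPatterns n)

-- Split a linear sequence of (letter , cut-before?) into blocks, a new block
-- starting at each marked position.  The first entry is assumed marked.
blocksAux : List Letter → List (Letter × Bool) → List (List Letter)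
blocksAux cur []                  = cur ∷ []
blocksAux cur ((l , true)  ∷ rest) = cur ∷ blocksAux (l ∷ []) rest
blocksAux cur ((l , false) ∷ rest) = blocksAux (cur ++ l ∷ []) rest

blocks : List (Letter × Bool) → List (List Letter)
blocks []             = []
blocks ((l , _) ∷ rest) = blocksAux (l ∷ []) rest

evalBlocks : List (List Letter) → Maybe (ℤ × ℕ)
evalBlocks []       = just (+ 1 , 0)
evalBlocks (w ∷ ws) with dict w | evalBlocks ws
... | just (c , k) | just (c' , k') = just (c * c' , k ℕ.+ k')
... | _            | _              = nothing

dropUncut : List (Letter × Bool) → List (Letter × Bool)
dropUncut []                 = []
dropUncut ((l , false) ∷ r) = dropUncut r
dropUncut ((l , true)  ∷ r) = (l , true) ∷ r

takeUncut : List (Letter × Bool) → List (Letter × Bool)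
takeUncut []                 = []
takeUncut ((l , false) ∷ r) = (l , false) ∷ takeUncut r
takeUncut ((l , true)  ∷ r) = []

anyTrue : List Bool → Bool
anyTrue []       = false
anyTrue (b ∷ bs) = b ∨ anyTrue bs

-- The parsing determined by the cut pattern cs on the cyclic word s
-- (positions 0 … N-1 around the circle).  It is a valid parsing iff there
-- is at least one cut and every block between consecutive cuts (read
-- cyclically) is a dictionary word; then we return (coefficient , weight).
parsing : List Letter → List Bool → Maybe (ℤ × ℕ)
parsing s cs with anyTrue cs
... | false = nothing
... | true  =
  let zs  = zip s cs
      rot = dropUncut zs ++ takeUncut zs
  in evalBlocks (blocks rot)

contrib : ℕ → Maybe (ℤ × ℕ) → ℤ
contrib w (just (c , k)) = if k ≡ᵇ w then c else + 0
contrib w nothing        = + 0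

-- c(S , w): sum of the coefficients of all parsings of S of weight w.
coeffL : List Letter → ℕ → ℤ
coeffL s w = foldr _+_ (+ 0) (map (λ cs → contrib w (parsing s cs)) (cutPatterns (Data.List.length s)))

-- c(S , w) for a cyclic sentence of length N given by a representative.
coeff : {N : ℕ} → Vec Letter N → ℕ → ℤ
coeff S w = coeffL (toList S) w

module Submission where

-- Evaluate |S| at an integer t.  There are 3×3 matrices N(l) over ℤ[t], one
-- per letter, on the states e (at a word boundary), x (inside a word that
-- needs one or two more letters) and q (inside a word that needs its final A),
-- such that |S|(t) = tr (N(l₁) ⋯ N(l_N)) for S = l₁ ⋯ l_N.  A symmetric matrix
-- P with P N(l) = N(l)ᵀ P and determinant d = -(t-1)² then gives
-- d·|S|(t) = d·|reverse S|(t); for t ≥ 2 we cancel d, and two integer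
-- polynomials that agree at every t ≥ 2 have the same coefficients.

open import Defs
open import Data.Nat using (ℕ; zero; suc; _≥_)
import Data.Nat as ℕ
import Data.Nat.Properties as ℕP
open import Data.Integer using (ℤ; +_; -[1+_]; -_; _+_; _*_; _-_; _^_; ∣_∣; _≟_)
import Data.Integer.Properties as ℤP
open import Data.Integer.Tactic.RingSolver using (solve-∀)
open import Data.Bool using (Bool; true; false; if_then_else_)
open import Data.List using (List; []; _∷_; _++_; map; zip; foldr; concatMap; length)
import Data.List as List
import Data.List.Properties as LP
open import Data.Maybe using (Maybe; just; nothing)
import Data.Maybe.Properties as MaybeP
import Data.Product.Properties as ProductP
open import Data.Product using (_×_; _,_; proj₁; proj₂; ∃-syntax; ∃₂)
open import Data.Empty using (⊥-elim)
open import Data.Vec using (Vec; reverse; toList)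
import Data.Vec.Properties as VP
open import Function using (_∘_)
open import Relation.Nullary using (Dec; yes; no)
open import Relation.Nullary.Decidable using (from-yes; _×-dec_)
open import Relation.Binary.PropositionalEquality
  using (_≡_; refl; sym; trans; cong; cong₂; subst; module ≡-Reasoning)

open ≡-Reasoning

-- Coordinates are indexed by the three states e, x, q; a matrix is the
-- vector of its rows.
record V3 (R : Set) : Set where
  constructor ⟨_,_,_⟩
  field e x q : R

M3 : Set → Set
M3 R = V3 (V3 R)

cong₃ : ∀ {R S T U : Set} (f : R → S → T → U) {a a′ b b′ c c′} →
        a ≡ a′ → b ≡ b′ → c ≡ c′ → f a b c ≡ f a′ b′ c′
cong₃ f refl refl refl = refl

mapV : ∀ {R S : Set} → (R → S) → V3 R → V3 S
mapV f ⟨ a , b , c ⟩ = ⟨ f a , f b , f c ⟩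

mapV-cong : ∀ {R S : Set} {f g : R → S} → (∀ a → f a ≡ g a) → ∀ v → mapV f v ≡ mapV g v
mapV-cong f≗g ⟨ a , b , c ⟩ = cong₃ ⟨_,_,_⟩ (f≗g a) (f≗g b) (f≗g c)

-- The matrix operations, over any carrier with an addition, a
-- multiplication, a zero and a one (no laws are assumed here: the
-- operations are used both over ℤ and over coefficient lists).
module MatrixOps {R : Set} (_⊕_ _⊛_ : R → R → R) (𝟘 𝟙 : R) where

  ⟪_,_⟫ : V3 R → V3 R → R
  ⟪ ⟨ a₁ , a₂ , a₃ ⟩ , ⟨ b₁ , b₂ , b₃ ⟩ ⟫ = ((a₁ ⊛ b₁) ⊕ (a₂ ⊛ b₂)) ⊕ (a₃ ⊛ b₃)

  column : (V3 R → R) → M3 R → V3 R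
  column i M = mapV i M

  _·_ : V3 R → M3 R → V3 R
  v · M = ⟨ ⟪ v , column V3.e M ⟫ , ⟪ v , column V3.x M ⟫ , ⟪ v , column V3.q M ⟫ ⟩

  _▷_ : M3 R → V3 R → V3 R
  M ▷ w = mapV ⟪_, w ⟫ M

  _⊗_ : M3 R → M3 R → M3 R
  M ⊗ M′ = mapV (_· M′) M

  infixl 7 _·_ _⊗_

  tp : M3 R → M3 R
  tp M = ⟨ column V3.e M , column V3.x M , column V3.q M ⟩

  Id : M3 R
  Id = ⟨ ⟨ 𝟙 , 𝟘 , 𝟘 ⟩ , ⟨ 𝟘 , 𝟙 , 𝟘 ⟩ , ⟨ 𝟘 , 𝟘 , 𝟙 ⟩ ⟩

  scal : R → M3 R
  scal d = ⟨ ⟨ d , 𝟘 , 𝟘 ⟩ , ⟨ 𝟘 , d , 𝟘 ⟩ , ⟨ 𝟘 , 𝟘 , d ⟩ ⟩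

  tr : M3 R → R
  tr M = (V3.e (V3.e M) ⊕ V3.x (V3.x M)) ⊕ V3.q (V3.q M)

  -- M with its boundary row removed: the transitions that continue a word
  interior : M3 R → M3 R
  interior M = ⟨ ⟨ 𝟘 , 𝟘 , 𝟘 ⟩ , V3.x M , V3.q M ⟩

  prod : {L : Set} → (L → M3 R) → List L → M3 R
  prod M []       = Id
  prod M (l ∷ ls) = M l ⊗ prod M ls

open MatrixOps {ℤ} _+_ _*_ (+ 0) (+ 1) public

⟪⟫-comm : ∀ u v → ⟪ u , v ⟫ ≡ ⟪ v , u ⟫
⟪⟫-comm ⟨ a₁ , a₂ , a₃ ⟩ ⟨ b₁ , b₂ , b₃ ⟩ =
  cong₂ _+_ (cong₂ _+_ (ℤP.*-comm a₁ b₁) (ℤP.*-comm a₂ b₂)) (ℤP.*-comm a₃ b₃)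

⟪⟫-adjoint : ∀ v M w → ⟪ v , M ▷ w ⟫ ≡ ⟪ v · M , w ⟫
⟪⟫-adjoint ⟨ v₁ , v₂ , v₃ ⟩ ⟨ ⟨ a₁ , a₂ , a₃ ⟩ , ⟨ a₄ , a₅ , a₆ ⟩ , ⟨ a₇ , a₈ , a₉ ⟩ ⟩ ⟨ w₁ , w₂ , w₃ ⟩ =
  identity v₁ v₂ v₃ a₁ a₂ a₃ a₄ a₅ a₆ a₇ a₈ a₉ w₁ w₂ w₃
  where
  identity : ∀ v₁ v₂ v₃ a₁ a₂ a₃ a₄ a₅ a₆ a₇ a₈ a₉ w₁ w₂ w₃ →
    v₁ * (a₁ * w₁ + a₂ * w₂ + a₃ * w₃) + v₂ * (a₄ * w₁ + a₅ * w₂ + a₆ * w₃) + v₃ * (a₇ * w₁ + a₈ * w₂ + a₉ * w₃)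
    ≡ (v₁ * a₁ + v₂ * a₄ + v₃ * a₇) * w₁ + (v₁ * a₂ + v₂ * a₅ + v₃ * a₈) * w₂ + (v₁ * a₃ + v₂ * a₆ + v₃ * a₉) * w₃
  identity = solve-∀

·-⊗ : ∀ v M M′ → v · (M ⊗ M′) ≡ v · M · M′
·-⊗ v M M′ = cong₃ ⟨_,_,_⟩ (⟪⟫-adjoint v M (column V3.e M′))
                           (⟪⟫-adjoint v M (column V3.x M′))
                           (⟪⟫-adjoint v M (column V3.q M′))

⊗-assoc : ∀ M M′ M″ → M ⊗ M′ ⊗ M″ ≡ M ⊗ (M′ ⊗ M″)
⊗-assoc M M′ M″ = sym (mapV-cong (λ r → ·-⊗ r M′ M″) M)

⟪⟫-unitₑ : ∀ v → ⟪ v , ⟨ + 1 , + 0 , + 0 ⟩ ⟫ ≡ V3.e v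
⟪⟫-unitₑ ⟨ a , b , c ⟩ = identity a b c
  where
  identity : ∀ a b c → a * + 1 + b * + 0 + c * + 0 ≡ a
  identity = solve-∀

⟪⟫-unitₓ : ∀ v → ⟪ v , ⟨ + 0 , + 1 , + 0 ⟩ ⟫ ≡ V3.x v
⟪⟫-unitₓ ⟨ a , b , c ⟩ = identity a b c
  where
  identity : ∀ a b c → a * + 0 + b * + 1 + c * + 0 ≡ b
  identity = solve-∀

⟪⟫-unit_q : ∀ v → ⟪ v , ⟨ + 0 , + 0 , + 1 ⟩ ⟫ ≡ V3.q v
⟪⟫-unit_q ⟨ a , b , c ⟩ = identity a b c
  where
  identity : ∀ a b c → a * + 0 + b * + 0 + c * + 1 ≡ c
  identity = solve-∀

·-Id : ∀ v → v · Id ≡ v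
·-Id v = cong₃ ⟨_,_,_⟩ (⟪⟫-unitₑ v) (⟪⟫-unitₓ v) (⟪⟫-unit_q v)

⊗-Id : ∀ M → M ⊗ Id ≡ M
⊗-Id M = mapV-cong ·-Id M

Id-⊗ : ∀ M → Id ⊗ M ≡ M
Id-⊗ M = cong₃ ⟨_,_,_⟩ (row ⟨ + 1 , + 0 , + 0 ⟩ V3.e ⟪⟫-unitₑ)
                       (row ⟨ + 0 , + 1 , + 0 ⟩ V3.x ⟪⟫-unitₓ)
                       (row ⟨ + 0 , + 0 , + 1 ⟩ V3.q ⟪⟫-unit_q)
  where
  row : ∀ u (i : V3 ℤ → ℤ) → (∀ v → ⟪ v , u ⟫ ≡ i v) →
        u · M ≡ ⟨ i (column V3.e M) , i (column V3.x M) , i (column V3.q M) ⟩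
  row u i pick = cong₃ ⟨_,_,_⟩ (trans (⟪⟫-comm u (column V3.e M)) (pick (column V3.e M)))
                               (trans (⟪⟫-comm u (column V3.x M)) (pick (column V3.x M)))
                               (trans (⟪⟫-comm u (column V3.q M)) (pick (column V3.q M)))

▷-tp : ∀ M c → M ▷ c ≡ c · tp M
▷-tp M c = cong₃ ⟨_,_,_⟩ (⟪⟫-comm (V3.e M) c) (⟪⟫-comm (V3.x M) c) (⟪⟫-comm (V3.q M) c)

tp-⊗ : ∀ M M′ → tp (M ⊗ M′) ≡ tp M′ ⊗ tp M
tp-⊗ M M′ = cong₃ ⟨_,_,_⟩ (▷-tp M (column V3.e M′)) (▷-tp M (column V3.x M′)) (▷-tp M (column V3.q M′))

tr-comm : ∀ M M′ → tr (M ⊗ M′) ≡ tr (M′ ⊗ M)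
tr-comm ⟨ ⟨ a₁ , a₂ , a₃ ⟩ , ⟨ a₄ , a₅ , a₆ ⟩ , ⟨ a₇ , a₈ , a₉ ⟩ ⟩
        ⟨ ⟨ b₁ , b₂ , b₃ ⟩ , ⟨ b₄ , b₅ , b₆ ⟩ , ⟨ b₇ , b₈ , b₉ ⟩ ⟩ =
  identity a₁ a₂ a₃ a₄ a₅ a₆ a₇ a₈ a₉ b₁ b₂ b₃ b₄ b₅ b₆ b₇ b₈ b₉
  where
  identity : ∀ a₁ a₂ a₃ a₄ a₅ a₆ a₇ a₈ a₉ b₁ b₂ b₃ b₄ b₅ b₆ b₇ b₈ b₉ →
    (a₁ * b₁ + a₂ * b₄ + a₃ * b₇) + (a₄ * b₂ + a₅ * b₅ + a₆ * b₈) + (a₇ * b₃ + a₈ * b₆ + a₉ * b₉)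
    ≡ (b₁ * a₁ + b₂ * a₄ + b₃ * a₇) + (b₄ * a₂ + b₅ * a₅ + b₆ * a₈) + (b₇ * a₃ + b₈ * a₆ + b₉ * a₉)
  identity = solve-∀

tr-scal : ∀ d M → tr (scal d ⊗ M) ≡ d * tr M
tr-scal d ⟨ ⟨ a₁ , a₂ , a₃ ⟩ , ⟨ a₄ , a₅ , a₆ ⟩ , ⟨ a₇ , a₈ , a₉ ⟩ ⟩ = identity d a₁ a₂ a₃ a₄ a₅ a₆ a₇ a₈ a₉
  where
  identity : ∀ d a₁ a₂ a₃ a₄ a₅ a₆ a₇ a₈ a₉ →
    (d * a₁ + + 0 * a₄ + + 0 * a₇) + (+ 0 * a₂ + d * a₅ + + 0 * a₈) + (+ 0 * a₃ + + 0 * a₆ + d * a₉)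
    ≡ d * (a₁ + a₅ + a₉)
  identity = solve-∀

-- Splitting off the boundary row of M: in tr (M M′) the walks leaving the
-- boundary state through M give the (e,e) entry of M M′, the others the
-- trace of M′ · interior M.
tr-split : ∀ M M′ → tr (M ⊗ M′) ≡ V3.e (V3.e M · M′) + tr (M′ ⊗ interior M)
tr-split ⟨ ⟨ a₁ , a₂ , a₃ ⟩ , ⟨ a₄ , a₅ , a₆ ⟩ , ⟨ a₇ , a₈ , a₉ ⟩ ⟩
         ⟨ ⟨ b₁ , b₂ , b₃ ⟩ , ⟨ b₄ , b₅ , b₆ ⟩ , ⟨ b₇ , b₈ , b₉ ⟩ ⟩ =
  identity a₁ a₂ a₃ a₄ a₅ a₆ a₇ a₈ a₉ b₁ b₂ b₃ b₄ b₅ b₆ b₇ b₈ b₉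
  where
  identity : ∀ a₁ a₂ a₃ a₄ a₅ a₆ a₇ a₈ a₉ b₁ b₂ b₃ b₄ b₅ b₆ b₇ b₈ b₉ →
    (a₁ * b₁ + a₂ * b₄ + a₃ * b₇) + (a₄ * b₂ + a₅ * b₅ + a₆ * b₈) + (a₇ * b₃ + a₈ * b₆ + a₉ * b₉)
    ≡ (a₁ * b₁ + a₂ * b₄ + a₃ * b₇)
      + ((b₁ * + 0 + b₂ * a₄ + b₃ * a₇) + (b₄ * + 0 + b₅ * a₅ + b₆ * a₈) + (b₇ * + 0 + b₈ * a₆ + b₉ * a₉))
  identity = solve-∀

boundary-split : ∀ v M M′ → V3.e (v · (M ⊗ M′)) ≡ V3.e v * V3.e (V3.e M · M′) + V3.e (v · interior M · M′)
boundary-split ⟨ v₁ , v₂ , v₃ ⟩ ⟨ ⟨ a₁ , a₂ , a₃ ⟩ , ⟨ a₄ , a₅ , a₆ ⟩ , ⟨ a₇ , a₈ , a₉ ⟩ ⟩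
               ⟨ ⟨ b₁ , _ , _ ⟩ , ⟨ b₄ , _ , _ ⟩ , ⟨ b₇ , _ , _ ⟩ ⟩ =
  identity v₁ v₂ v₃ a₁ a₂ a₃ a₄ a₅ a₆ a₇ a₈ a₉ b₁ b₄ b₇
  where
  identity : ∀ v₁ v₂ v₃ a₁ a₂ a₃ a₄ a₅ a₆ a₇ a₈ a₉ b₁ b₄ b₇ →
    v₁ * (a₁ * b₁ + a₂ * b₄ + a₃ * b₇) + v₂ * (a₄ * b₁ + a₅ * b₄ + a₆ * b₇) + v₃ * (a₇ * b₁ + a₈ * b₄ + a₉ * b₇)
    ≡ v₁ * (a₁ * b₁ + a₂ * b₄ + a₃ * b₇)
      + ((v₁ * + 0 + v₂ * a₄ + v₃ * a₇) * b₁ + (v₁ * + 0 + v₂ * a₅ + v₃ * a₈) * b₄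
         + (v₁ * + 0 + v₂ * a₆ + v₃ * a₉) * b₇)
  identity = solve-∀

prod-++ : ∀ {L : Set} (M : L → M3 ℤ) u w → prod M (u ++ w) ≡ prod M u ⊗ prod M w
prod-++ M []      w = sym (Id-⊗ (prod M w))
prod-++ M (l ∷ u) w = trans (cong (M l ⊗_) (prod-++ M u w)) (sym (⊗-assoc (M l) (prod M u) (prod M w)))

prod-snoc : ∀ {L : Set} (M : L → M3 ℤ) u l → prod M (u ++ l ∷ []) ≡ prod M u ⊗ M l
prod-snoc M u l = trans (prod-++ M u (l ∷ [])) (cong (prod M u ⊗_) (⊗-Id (M l)))

-- For the order e < q < x of the states, `strict a b c` only has the
-- transitions x → e, x → q and q → e.  Products of such matrices have zero
-- trace, and any three of them multiply to zero.
strict : ℤ → ℤ → ℤ → M3 ℤ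
strict a b c = ⟨ ⟨ + 0 , + 0 , + 0 ⟩ , ⟨ a , + 0 , b ⟩ , ⟨ c , + 0 , + 0 ⟩ ⟩

O : M3 ℤ
O = strict (+ 0) (+ 0) (+ 0)

IsStrict : M3 ℤ → Set
IsStrict M = ∃[ a ] ∃[ b ] ∃[ c ] M ≡ strict a b c

strict-⊗ : ∀ a b c a′ b′ c′ → strict a b c ⊗ strict a′ b′ c′ ≡ strict (b * c′) (+ 0) (+ 0)
strict-⊗ a b c a′ b′ c′ = cong₃ ⟨_,_,_⟩ refl
  (cong₃ ⟨_,_,_⟩ (row-x₁ a b a′ c′) (row-x₂ a b) (row-x₂ a b))
  (cong₃ ⟨_,_,_⟩ (row-q c) (row-q c) (row-q c))
  where
  row-x₁ : ∀ a b a′ c′ → a * + 0 + + 0 * a′ + b * c′ ≡ b * c′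
  row-x₁ = solve-∀
  row-x₂ : ∀ a b → a * + 0 + + 0 + b * + 0 ≡ + 0
  row-x₂ = solve-∀
  row-q : ∀ c → c * + 0 + + 0 + + 0 ≡ + 0
  row-q = solve-∀

boundary-·-O : ∀ v → V3.e (v · O) ≡ + 0
boundary-·-O ⟨ v₁ , v₂ , v₃ ⟩ = identity v₁ v₂ v₃
  where
  identity : ∀ v₁ v₂ v₃ → v₁ * + 0 + v₂ * + 0 + v₃ * + 0 ≡ + 0
  identity = solve-∀

module _ {L : Set} (S : L → M3 ℤ) (S-strict : ∀ l → IsStrict (S l)) where

  prod-strict : ∀ l ls → IsStrict (prod S (l ∷ ls))
  prod-strict l [] with S-strict l
  ... | a , b , c , Sl≡ = a , b , c , trans (⊗-Id (S l)) Sl≡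
  prod-strict l (l′ ∷ ls) with S-strict l | prod-strict l′ ls
  ... | a , b , c , Sl≡ | a′ , b′ , c′ , P≡ =
    b * c′ , + 0 , + 0 , trans (cong₂ _⊗_ Sl≡ P≡) (strict-⊗ a b c a′ b′ c′)

  prod-traceless : ∀ l ls → tr (prod S (l ∷ ls)) ≡ + 0
  prod-traceless l ls with prod-strict l ls
  ... | a , b , c , P≡ = cong tr P≡

  -- every walk through the interior states has length at most two
  prod-nilpotent : ∀ l₁ l₂ l₃ ls → prod S (l₁ ∷ l₂ ∷ l₃ ∷ ls) ≡ O
  prod-nilpotent l₁ l₂ l₃ ls with S-strict l₁ | S-strict l₂ | prod-strict l₃ ls
  ... | a₁ , b₁ , c₁ , S₁≡ | a₂ , b₂ , c₂ , S₂≡ | a₃ , b₃ , c₃ , P≡ = begin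
    S l₁ ⊗ (S l₂ ⊗ prod S (l₃ ∷ ls))
      ≡⟨ cong₂ _⊗_ S₁≡ (trans (cong₂ _⊗_ S₂≡ P≡) (strict-⊗ a₂ b₂ c₂ a₃ b₃ c₃)) ⟩
    strict a₁ b₁ c₁ ⊗ strict (b₂ * c₃) (+ 0) (+ 0)
      ≡⟨ strict-⊗ a₁ b₁ c₁ (b₂ * c₃) (+ 0) (+ 0) ⟩
    strict (b₁ * + 0) (+ 0) (+ 0)
      ≡⟨ cong (λ a → strict a (+ 0) (+ 0)) (ℤP.*-zeroʳ b₁) ⟩
    O ∎

-- Trace reversal

module _ {L : Set} (M : L → M3 ℤ) (P P′ : M3 ℤ) (d : ℤ)
         (intertwines : ∀ l → P ⊗ M l ≡ tp (M l) ⊗ P)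
         (P′P : P′ ⊗ P ≡ scal d) (PP′ : P ⊗ P′ ≡ scal d) where

  intertwines-word : ∀ ls → P ⊗ prod M ls ≡ tp (prod M (List.reverse ls)) ⊗ P
  intertwines-word []       = trans (⊗-Id P) (sym (Id-⊗ P))
  intertwines-word (l ∷ ls) = begin
    P ⊗ (M l ⊗ prod M ls)                     ≡⟨ sym (⊗-assoc P (M l) (prod M ls)) ⟩
    P ⊗ M l ⊗ prod M ls                       ≡⟨ cong (_⊗ prod M ls) (intertwines l) ⟩
    tp (M l) ⊗ P ⊗ prod M ls                  ≡⟨ ⊗-assoc (tp (M l)) P (prod M ls) ⟩
    tp (M l) ⊗ (P ⊗ prod M ls)                ≡⟨ cong (tp (M l) ⊗_) (intertwines-word ls) ⟩
    tp (M l) ⊗ (tp R ⊗ P)                     ≡⟨ sym (⊗-assoc (tp (M l)) (tp R) P) ⟩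
    tp (M l) ⊗ tp R ⊗ P                       ≡⟨ cong (_⊗ P) (sym (tp-⊗ R (M l))) ⟩
    tp (R ⊗ M l) ⊗ P                          ≡⟨ cong (λ Q → tp Q ⊗ P) (sym (prod-snoc M (List.reverse ls) l)) ⟩
    tp (prod M (List.reverse ls ++ l ∷ [])) ⊗ P ≡⟨ cong (λ w → tp (prod M w) ⊗ P) (sym (LP.unfold-reverse l ls)) ⟩
    tp (prod M (List.reverse (l ∷ ls))) ⊗ P   ∎
    where
    R = prod M (List.reverse ls)

  trace-reversal : ∀ ls → d * tr (prod M ls) ≡ d * tr (prod M (List.reverse ls))
  trace-reversal ls = begin
    d * tr W                  ≡⟨ sym (tr-scal d W) ⟩
    tr (scal d ⊗ W)           ≡⟨ cong (λ Q → tr (Q ⊗ W)) (sym P′P) ⟩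
    tr (P′ ⊗ P ⊗ W)           ≡⟨ cong tr (⊗-assoc P′ P W) ⟩
    tr (P′ ⊗ (P ⊗ W))         ≡⟨ cong (λ Q → tr (P′ ⊗ Q)) (intertwines-word ls) ⟩
    tr (P′ ⊗ (tp R ⊗ P))      ≡⟨ tr-comm P′ (tp R ⊗ P) ⟩
    tr (tp R ⊗ P ⊗ P′)        ≡⟨ cong tr (⊗-assoc (tp R) P P′) ⟩
    tr (tp R ⊗ (P ⊗ P′))      ≡⟨ cong (λ Q → tr (tp R ⊗ Q)) PP′ ⟩
    tr (tp R ⊗ scal d)        ≡⟨ tr-comm (tp R) (scal d) ⟩
    tr (scal d ⊗ tp R)        ≡⟨ tr-scal d (tp R) ⟩
    d * tr R                  ∎
    where
    W = prod M ls
    R = prod M (List.reverse ls)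

-- Σ_{x ∈ xs} f x (this is how `coeffL` is written in Defs)
sumOver : {S : Set} → List S → (S → ℤ) → ℤ
sumOver xs f = foldr _+_ (+ 0) (map f xs)

sumOver-cong : ∀ {S : Set} (xs : List S) {f g : S → ℤ} → (∀ x → f x ≡ g x) → sumOver xs f ≡ sumOver xs g
sumOver-cong []       f≗g = refl
sumOver-cong (x ∷ xs) f≗g = cong₂ _+_ (f≗g x) (sumOver-cong xs f≗g)

sumOver-+ : ∀ {S : Set} (xs : List S) (f g : S → ℤ) →
            sumOver xs (λ x → f x + g x) ≡ sumOver xs f + sumOver xs g
sumOver-+ []       f g = refl
sumOver-+ (x ∷ xs) f g = trans (cong (_+_ (f x + g x)) (sumOver-+ xs f g))
                               (interchange (f x) (g x) (sumOver xs f) (sumOver xs g))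
  where
  interchange : ∀ a b c d → a + b + (c + d) ≡ a + c + (b + d)
  interchange = solve-∀

sumOver-* : ∀ {S : Set} (xs : List S) (k : ℤ) (f : S → ℤ) → sumOver xs (λ x → k * f x) ≡ k * sumOver xs f
sumOver-* []       k f = sym (ℤP.*-zeroʳ k)
sumOver-* (x ∷ xs) k f = trans (cong (_+_ (k * f x)) (sumOver-* xs k f)) (sym (ℤP.*-distribˡ-+ k (f x) _))

sumOver-map : ∀ {S T : Set} (h : S → T) (xs : List S) (f : T → ℤ) → sumOver (map h xs) f ≡ sumOver xs (f ∘ h)
sumOver-map h []       f = refl
sumOver-map h (x ∷ xs) f = cong (_+_ (f (h x))) (sumOver-map h xs f)

sumOver-cuts : ∀ n (f : List Bool → ℤ) →
  sumOver (cutPatterns (suc n)) f ≡ sumOver (cutPatterns n) (λ bs → f (true ∷ bs) + f (false ∷ bs))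
sumOver-cuts n f = go (cutPatterns n)
  where
  go : ∀ bss → sumOver (concatMap (λ bs → (true ∷ bs) ∷ (false ∷ bs) ∷ []) bss) f
               ≡ sumOver bss (λ bs → f (true ∷ bs) + f (false ∷ bs))
  go []         = refl
  go (bs ∷ bss) = trans (cong (λ s → f (true ∷ bs) + (f (false ∷ bs) + s)) (go bss))
                        (sym (ℤP.+-assoc (f (true ∷ bs)) (f (false ∷ bs)) _))

valueAt : ℤ → Maybe (ℤ × ℕ) → ℤ
valueAt t nothing        = + 0
valueAt t (just (c , k)) = c * t ^ k

valueAt-evalBlocks : ∀ t w ws → valueAt t (evalBlocks (w ∷ ws)) ≡ valueAt t (dict w) * valueAt t (evalBlocks ws)
valueAt-evalBlocks t w ws with dict w | evalBlocks ws
... | just (c , k) | just (c′ , k′) =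
  trans (cong ((c * c′) *_) (ℤP.^-distribˡ-+-* t k k′)) (rearrange c c′ (t ^ k) (t ^ k′))
  where
  rearrange : ∀ c c′ a a′ → c * c′ * (a * a′) ≡ c * a * (c′ * a′)
  rearrange = solve-∀
... | just (c , k) | nothing = sym (ℤP.*-zeroʳ (c * t ^ k))
... | nothing      | _       = refl

linearValue : ℤ → List Letter → List (Letter × Bool) → ℤ
linearValue t cur zs = valueAt t (evalBlocks (blocksAux cur zs))

linearValue-cut : ∀ t cur l zs → linearValue t cur ((l , true) ∷ zs) ≡ valueAt t (dict cur) * linearValue t (l ∷ []) zs
linearValue-cut t cur l zs = valueAt-evalBlocks t cur (blocksAux (l ∷ []) zs)

uncut : List Letter → List (Letter × Bool)
uncut = map (λ l → l , false)

uncut-snoc : ∀ p l zs → uncut (p ++ l ∷ []) ++ zs ≡ uncut p ++ (l , false) ∷ zs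
uncut-snoc p l zs = trans (cong (_++ zs) (LP.map-++ (λ l → l , false) p (l ∷ []))) (LP.++-assoc (uncut p) ((l , false) ∷ []) zs)

linearValue-uncut : ∀ t cur p → linearValue t cur (uncut p) ≡ valueAt t (dict (cur ++ p))
linearValue-uncut t cur []      = begin
  linearValue t cur []             ≡⟨ valueAt-evalBlocks t cur [] ⟩
  valueAt t (dict cur) * + 1       ≡⟨ ℤP.*-identityʳ _ ⟩
  valueAt t (dict cur)             ≡⟨ cong (valueAt t ∘ dict) (sym (LP.++-identityʳ cur)) ⟩
  valueAt t (dict (cur ++ []))     ∎
linearValue-uncut t cur (l ∷ p) =
  trans (linearValue-uncut t (cur ++ l ∷ []) p) (cong (valueAt t ∘ dict) (LP.++-assoc cur (l ∷ []) p))

-- The parsing of the circle p ++ u cut by bs, where no cut falls inside p.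
-- For p = [] this is `parsing`.
parsingFrom : List Letter → List Letter → List Bool → Maybe (ℤ × ℕ)
parsingFrom p u bs =
  if anyTrue bs then evalBlocks (blocks (dropUncut (zip u bs) ++ uncut p ++ takeUncut (zip u bs))) else nothing

parsing≡parsingFrom : ∀ s bs → parsing s bs ≡ parsingFrom [] s bs
parsing≡parsingFrom s bs with anyTrue bs
... | true  = refl
... | false = refl

parsingFrom-cut : ∀ p l u bs → parsingFrom p (l ∷ u) (true ∷ bs) ≡ evalBlocks (blocksAux (l ∷ []) (zip u bs ++ uncut p))
parsingFrom-cut p l u bs = cong (λ zs → evalBlocks (blocksAux (l ∷ []) (zip u bs ++ zs))) (LP.++-identityʳ (uncut p))

parsingFrom-uncut : ∀ p l u bs → parsingFrom p (l ∷ u) (false ∷ bs) ≡ parsingFrom (p ++ l ∷ []) u bs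
parsingFrom-uncut p l u bs =
  cong (λ zs → if anyTrue bs then evalBlocks (blocks (dropUncut (zip u bs) ++ zs)) else nothing)
       (sym (uncut-snoc p l (takeUncut (zip u bs))))

-- Parsings as a trace.

module ParsingsAsTrace (t : ℤ) (N : Letter → M3 ℤ)
  (recognizes : ∀ c cs → V3.e (V3.e (N c) · prod (interior ∘ N) cs) ≡ valueAt t (dict (c ∷ cs)))
  (interior-traceless : ∀ c cs → tr (prod (interior ∘ N) (c ∷ cs)) ≡ + 0) where

  K : Letter → M3 ℤ
  K = interior ∘ N

  block : Letter → List Letter → V3 ℤ
  block c cs = V3.e (N c) · prod K cs

  block-++ : ∀ c cs p → block c (cs ++ p) ≡ block c cs · prod K p
  block-++ c cs p = trans (cong (V3.e (N c) ·_) (prod-++ K cs p)) (·-⊗ (V3.e (N c)) (prod K cs) (prod K p))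

  block-snoc : ∀ c cs l → block c (cs ++ l ∷ []) ≡ block c cs · K l
  block-snoc c cs l = trans (block-++ c cs (l ∷ [])) (cong (block c cs ·_) (⊗-Id (K l)))

  linearSum : List Letter → List Letter → List (Letter × Bool) → ℤ
  linearSum cur u zs = sumOver (cutPatterns (length u)) (λ bs → linearValue t cur (zip u bs ++ zs))

  linear-sum : ∀ Z zs → (∀ c cs → linearValue t (c ∷ cs) zs ≡ V3.e (block c cs · Z)) →
               ∀ u c cs → linearSum (c ∷ cs) u zs ≡ V3.e (block c cs · (prod N u ⊗ Z))
  linear-sum Z zs tail [] c cs = begin
    linearValue t (c ∷ cs) zs + + 0   ≡⟨ ℤP.+-identityʳ _ ⟩
    linearValue t (c ∷ cs) zs         ≡⟨ tail c cs ⟩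
    V3.e (block c cs · Z)             ≡⟨ cong (λ Q → V3.e (block c cs · Q)) (sym (Id-⊗ Z)) ⟩
    V3.e (block c cs · (Id ⊗ Z))      ∎
  linear-sum Z zs tail (l ∷ u) c cs = begin
    linearSum (c ∷ cs) (l ∷ u) zs
      ≡⟨ sumOver-cuts (length u) _ ⟩
    sumOver cuts (λ bs → linearValue t (c ∷ cs) ((l , true) ∷ zip u bs ++ zs) + linearValue t (c ∷ cs ++ l ∷ []) (zip u bs ++ zs))
      ≡⟨ sumOver-cong cuts (λ bs → cong (_+ linearValue t (c ∷ cs ++ l ∷ []) (zip u bs ++ zs))
                                        (linearValue-cut t (c ∷ cs) l (zip u bs ++ zs))) ⟩
    sumOver cuts (λ bs → w * linearValue t (l ∷ []) (zip u bs ++ zs) + linearValue t (c ∷ cs ++ l ∷ []) (zip u bs ++ zs))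
      ≡⟨ sumOver-+ cuts _ _ ⟩
    sumOver cuts (λ bs → w * linearValue t (l ∷ []) (zip u bs ++ zs)) + linearSum (c ∷ cs ++ l ∷ []) u zs
      ≡⟨ cong (_+ linearSum (c ∷ cs ++ l ∷ []) u zs) (sumOver-* cuts w (λ bs → linearValue t (l ∷ []) (zip u bs ++ zs))) ⟩
    w * linearSum (l ∷ []) u zs + linearSum (c ∷ cs ++ l ∷ []) u zs
      ≡⟨ cong₂ (λ a b → w * a + b) (linear-sum Z zs tail u l []) (linear-sum Z zs tail u c (cs ++ l ∷ [])) ⟩
    w * V3.e (block l [] · Y) + V3.e (block c (cs ++ l ∷ []) · Y)
      ≡⟨ cong₃ (λ a r v → a * V3.e (r · Y) + V3.e (v · Y)) (sym (recognizes c cs)) (·-Id (V3.e (N l))) (block-snoc c cs l) ⟩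
    V3.e (block c cs) * V3.e (V3.e (N l) · Y) + V3.e (block c cs · K l · Y)
      ≡⟨ sym (boundary-split (block c cs) (N l) Y) ⟩
    V3.e (block c cs · (N l ⊗ Y))
      ≡⟨ cong (λ Q → V3.e (block c cs · Q)) (sym (⊗-assoc (N l) (prod N u) Z)) ⟩
    V3.e (block c cs · (prod N (l ∷ u) ⊗ Z)) ∎
    where
    cuts = cutPatterns (length u)
    w    = valueAt t (dict (c ∷ cs))
    Y    = prod N u ⊗ Z

  uncut-tail : ∀ p c cs → linearValue t (c ∷ cs) (uncut p) ≡ V3.e (block c cs · prod K p)
  uncut-tail p c cs = begin
    linearValue t (c ∷ cs) (uncut p)   ≡⟨ linearValue-uncut t (c ∷ cs) p ⟩
    valueAt t (dict (c ∷ cs ++ p))     ≡⟨ sym (recognizes c (cs ++ p)) ⟩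
    V3.e (block c (cs ++ p))           ≡⟨ cong V3.e (block-++ c cs p) ⟩
    V3.e (block c cs · prod K p)       ∎

  cyclicSum : List Letter → List Letter → ℤ
  cyclicSum p u = sumOver (cutPatterns (length u)) (λ bs → valueAt t (parsingFrom p u bs))

  -- either the first letter of u carries a cut (a linear reading of the
  -- rotated circle) or it joins the uncut prefix
  cyclicSum-∷ : ∀ p l u → cyclicSum p (l ∷ u) ≡ V3.e (V3.e (N l) · (prod N u ⊗ prod K p)) + cyclicSum (p ++ l ∷ []) u
  cyclicSum-∷ p l u = begin
    cyclicSum p (l ∷ u)
      ≡⟨ sumOver-cuts (length u) _ ⟩
    sumOver cuts (λ bs → valueAt t (parsingFrom p (l ∷ u) (true ∷ bs)) + valueAt t (parsingFrom p (l ∷ u) (false ∷ bs)))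
      ≡⟨ sumOver-cong cuts (λ bs → cong₂ _+_ (cong (valueAt t) (parsingFrom-cut p l u bs))
                                               (cong (valueAt t) (parsingFrom-uncut p l u bs))) ⟩
    sumOver cuts (λ bs → linearValue t (l ∷ []) (zip u bs ++ uncut p) + valueAt t (parsingFrom (p ++ l ∷ []) u bs))
      ≡⟨ sumOver-+ cuts _ _ ⟩
    linearSum (l ∷ []) u (uncut p) + cyclicSum (p ++ l ∷ []) u
      ≡⟨ cong (_+ cyclicSum (p ++ l ∷ []) u) (linear-sum (prod K p) (uncut p) (uncut-tail p) u l []) ⟩
    V3.e (block l [] · (prod N u ⊗ prod K p)) + cyclicSum (p ++ l ∷ []) u
      ≡⟨ cong (λ r → V3.e (r · (prod N u ⊗ prod K p)) + cyclicSum (p ++ l ∷ []) u) (·-Id (V3.e (N l))) ⟩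
    V3.e (V3.e (N l) · (prod N u ⊗ prod K p)) + cyclicSum (p ++ l ∷ []) u ∎
    where
    cuts = cutPatterns (length u)

  -- The key invariant, by induction on u: the parsings of p ++ u (p uncut)
  -- together with the walks avoiding the boundary give tr (N(u) K(p)).
  cyclic-sum : ∀ p u → cyclicSum p u + tr (prod K (p ++ u)) ≡ tr (prod N u ⊗ prod K p)
  cyclic-sum p [] = begin
    + 0 + tr (prod K (p ++ []))   ≡⟨ ℤP.+-identityˡ _ ⟩
    tr (prod K (p ++ []))         ≡⟨ cong (tr ∘ prod K) (LP.++-identityʳ p) ⟩
    tr (prod K p)                 ≡⟨ cong tr (sym (Id-⊗ (prod K p))) ⟩
    tr (Id ⊗ prod K p)            ∎
  cyclic-sum p (l ∷ u) = begin
    cyclicSum p (l ∷ u) + tr (prod K (p ++ l ∷ u))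
      ≡⟨ cong (_+ tr (prod K (p ++ l ∷ u))) (cyclicSum-∷ p l u) ⟩
    E + cyclicSum p′ u + tr (prod K (p ++ l ∷ u))
      ≡⟨ ℤP.+-assoc E (cyclicSum p′ u) _ ⟩
    E + (cyclicSum p′ u + tr (prod K (p ++ l ∷ u)))
      ≡⟨ cong (λ w → E + (cyclicSum p′ u + tr (prod K w))) (sym (LP.++-assoc p (l ∷ []) u)) ⟩
    E + (cyclicSum p′ u + tr (prod K (p′ ++ u)))
      ≡⟨ cong (_+_ E) (cyclic-sum p′ u) ⟩
    E + tr (prod N u ⊗ prod K p′)
      ≡⟨ cong (λ Q → E + tr (prod N u ⊗ Q)) (prod-snoc K p l) ⟩
    E + tr (prod N u ⊗ (prod K p ⊗ K l))
      ≡⟨ cong (λ Q → E + tr Q) (sym (⊗-assoc (prod N u) (prod K p) (K l))) ⟩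
    E + tr (Y ⊗ K l)
      ≡⟨ sym (tr-split (N l) Y) ⟩
    tr (N l ⊗ Y)
      ≡⟨ cong tr (sym (⊗-assoc (N l) (prod N u) (prod K p))) ⟩
    tr (prod N (l ∷ u) ⊗ prod K p) ∎
    where
    p′ = p ++ l ∷ []
    Y  = prod N u ⊗ prod K p
    E  = V3.e (V3.e (N l) · Y)

  trace-formula : ∀ c cs → sumOver (cutPatterns (length (c ∷ cs))) (λ bs → valueAt t (parsing (c ∷ cs) bs))
                           ≡ tr (prod N (c ∷ cs))
  trace-formula c cs = begin
    sumOver (cutPatterns (length s)) (λ bs → valueAt t (parsing s bs))
      ≡⟨ sumOver-cong (cutPatterns (length s)) (λ bs → cong (valueAt t) (parsing≡parsingFrom s bs)) ⟩
    cyclicSum [] s                       ≡⟨ sym (ℤP.+-identityʳ _) ⟩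
    cyclicSum [] s + + 0                 ≡⟨ cong (_+_ (cyclicSum [] s)) (sym (interior-traceless c cs)) ⟩
    cyclicSum [] s + tr (prod K s)       ≡⟨ cyclic-sum [] s ⟩
    tr (prod N s ⊗ Id)                   ≡⟨ cong tr (⊗-Id (prod N s)) ⟩
    tr (prod N s)                        ∎
    where
    s = c ∷ cs

-- Coefficient extraction.

-- A list of monomials (parsing outcomes) defines an integer polynomial;
-- `evaluation t` is its value at t and `coefficient w` its coefficient of t^w.
evaluation : ℤ → List (Maybe (ℤ × ℕ)) → ℤ
evaluation t ms = sumOver ms (valueAt t)

coefficient : ℕ → List (Maybe (ℤ × ℕ)) → ℤ
coefficient w ms = sumOver ms (contrib w)

lowerDegree : Maybe (ℤ × ℕ) → Maybe (ℤ × ℕ)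
lowerDegree nothing            = nothing
lowerDegree (just (c , zero))  = nothing
lowerDegree (just (c , suc k)) = just (c , k)

+0≡+0+t*+0 : ∀ t → + 0 ≡ + 0 + t * + 0
+0≡+0+t*+0 = solve-∀

valueAt-lowerDegree : ∀ t m → valueAt t m ≡ contrib 0 m + t * valueAt t (lowerDegree m)
valueAt-lowerDegree t nothing            = +0≡+0+t*+0 t
valueAt-lowerDegree t (just (c , zero))  = identity c t
  where
  identity : ∀ c t → c * + 1 ≡ c + t * + 0
  identity = solve-∀
valueAt-lowerDegree t (just (c , suc k)) = identity c t (t ^ k)
  where
  identity : ∀ c t a → c * (t * a) ≡ + 0 + t * (c * a)
  identity = solve-∀

contrib-lowerDegree : ∀ w m → contrib (suc w) m ≡ contrib w (lowerDegree m)
contrib-lowerDegree w nothing            = refl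
contrib-lowerDegree w (just (c , zero))  = refl
contrib-lowerDegree w (just (c , suc k)) = refl

evaluation-lowerDegree : ∀ t ms → evaluation t ms ≡ coefficient 0 ms + t * evaluation t (map lowerDegree ms)
evaluation-lowerDegree t ms = begin
  sumOver ms (valueAt t)
    ≡⟨ sumOver-cong ms (valueAt-lowerDegree t) ⟩
  sumOver ms (λ m → contrib 0 m + t * valueAt t (lowerDegree m))
    ≡⟨ sumOver-+ ms (contrib 0) _ ⟩
  coefficient 0 ms + sumOver ms (λ m → t * valueAt t (lowerDegree m))
    ≡⟨ cong (_+_ (coefficient 0 ms)) (sumOver-* ms t (valueAt t ∘ lowerDegree)) ⟩
  coefficient 0 ms + t * sumOver ms (valueAt t ∘ lowerDegree)
    ≡⟨ cong (λ s → coefficient 0 ms + t * s) (sym (sumOver-map lowerDegree ms (valueAt t))) ⟩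
  coefficient 0 ms + t * evaluation t (map lowerDegree ms) ∎

coefficient-lowerDegree : ∀ w ms → coefficient (suc w) ms ≡ coefficient w (map lowerDegree ms)
coefficient-lowerDegree w ms =
  trans (sumOver-cong ms (contrib-lowerDegree w)) (sym (sumOver-map lowerDegree ms (contrib w)))

divisible-by-all⇒zero : ∀ a → (∀ n → ∃[ b ] a ≡ + suc (suc n) * b) → a ≡ + 0
divisible-by-all⇒zero a divisible with divisible ∣ a ∣
... | b , a≡ = ℤP.∣i∣≡0⇒i≡0 (n≡[2+n]*m⇒n≡0 ∣ a ∣ ∣ b ∣ (trans (cong ∣_∣ a≡) (ℤP.abs-* (+ suc (suc ∣ a ∣)) b)))
  where
  n≡[2+n]*m⇒n≡0 : ∀ n m → n ≡ suc (suc n) ℕ.* m → n ≡ 0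
  n≡[2+n]*m⇒n≡0 n zero    n≡ = trans n≡ (ℕP.*-zeroʳ (suc (suc n)))
  n≡[2+n]*m⇒n≡0 n (suc m) n≡ =
    ⊥-elim (ℕP.1+n≰n (ℕP.≤-trans (ℕP.n≤1+n (suc n)) (ℕP.≤-trans (ℕP.m≤m*n (suc (suc n)) (suc m)) (ℕP.≤-reflexive (sym n≡)))))

affine-agreement : ∀ c₁ c₂ (e₁ e₂ : ℕ → ℤ) →
  (∀ n → c₁ + + suc (suc n) * e₁ n ≡ c₂ + + suc (suc n) * e₂ n) →
  c₁ ≡ c₂ × (∀ n → e₁ n ≡ e₂ n)
affine-agreement c₁ c₂ e₁ e₂ agree = c₁≡c₂ , e₁≡e₂
  where
  difference : ∀ n → c₁ - c₂ ≡ + suc (suc n) * (e₂ n - e₁ n)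
  difference n = begin
    c₁ - c₂                                       ≡⟨ rearrange c₁ c₂ T (e₁ n) (e₂ n) ⟩
    c₁ + T * e₁ n - (c₂ + T * e₂ n) + T * (e₂ n - e₁ n)
                                                  ≡⟨ cong (λ a → a - (c₂ + T * e₂ n) + T * (e₂ n - e₁ n)) (agree n) ⟩
    c₂ + T * e₂ n - (c₂ + T * e₂ n) + T * (e₂ n - e₁ n)
                                                  ≡⟨ cong (_+ T * (e₂ n - e₁ n)) (ℤP.+-inverseʳ (c₂ + T * e₂ n)) ⟩
    + 0 + T * (e₂ n - e₁ n)                       ≡⟨ ℤP.+-identityˡ _ ⟩
    T * (e₂ n - e₁ n)                             ∎
    where
    T = + suc (suc n)
    rearrange : ∀ c₁ c₂ T e₁ e₂ → c₁ - c₂ ≡ c₁ + T * e₁ - (c₂ + T * e₂) + T * (e₂ - e₁)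
    rearrange = solve-∀

  c₁-c₂≡0 : c₁ - c₂ ≡ + 0
  c₁-c₂≡0 = divisible-by-all⇒zero (c₁ - c₂) (λ n → e₂ n - e₁ n , difference n)

  c₁≡c₂ : c₁ ≡ c₂
  c₁≡c₂ = ℤP.i-j≡0⇒i≡j c₁ c₂ c₁-c₂≡0

  e₁≡e₂ : ∀ n → e₁ n ≡ e₂ n
  e₁≡e₂ n = sym (ℤP.i-j≡0⇒i≡j (e₂ n) (e₁ n)
    (ℤP.*-cancelˡ-≡ (+ suc (suc n)) _ (+ 0) (trans (sym (difference n)) (trans c₁-c₂≡0 (sym (ℤP.*-zeroʳ (+ suc (suc n))))))))

split-agreement : ∀ ms₁ ms₂ → (∀ n → evaluation (+ suc (suc n)) ms₁ ≡ evaluation (+ suc (suc n)) ms₂) →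
  coefficient 0 ms₁ ≡ coefficient 0 ms₂
  × (∀ n → evaluation (+ suc (suc n)) (map lowerDegree ms₁) ≡ evaluation (+ suc (suc n)) (map lowerDegree ms₂))
split-agreement ms₁ ms₂ agree =
  affine-agreement (coefficient 0 ms₁) (coefficient 0 ms₂)
    (λ n → evaluation (+ suc (suc n)) (map lowerDegree ms₁)) (λ n → evaluation (+ suc (suc n)) (map lowerDegree ms₂))
    (λ n → trans (sym (evaluation-lowerDegree (+ suc (suc n)) ms₁))
                 (trans (agree n) (evaluation-lowerDegree (+ suc (suc n)) ms₂)))

coefficients-agree : ∀ w ms₁ ms₂ → (∀ n → evaluation (+ suc (suc n)) ms₁ ≡ evaluation (+ suc (suc n)) ms₂) →
                     coefficient w ms₁ ≡ coefficient w ms₂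
coefficients-agree zero    ms₁ ms₂ agree = proj₁ (split-agreement ms₁ ms₂ agree)
coefficients-agree (suc w) ms₁ ms₂ agree = begin
  coefficient (suc w) ms₁                 ≡⟨ coefficient-lowerDegree w ms₁ ⟩
  coefficient w (map lowerDegree ms₁)     ≡⟨ coefficients-agree w (map lowerDegree ms₁) (map lowerDegree ms₂)
                                                               (proj₂ (split-agreement ms₁ ms₂ agree)) ⟩
  coefficient w (map lowerDegree ms₂)     ≡⟨ sym (coefficient-lowerDegree w ms₂) ⟩
  coefficient (suc w) ms₂                 ∎

-- coefficient lists, constant term first, with sum, scaling and product
Poly : Set
Poly = List ℤ

infixl 6 _+ᴾ_
infixl 7 _*ᴾ_

_+ᴾ_ : Poly → Poly → Poly
[]      +ᴾ q       = q
(a ∷ p) +ᴾ []      = a ∷ p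
(a ∷ p) +ᴾ (b ∷ q) = a + b ∷ p +ᴾ q

scaleᴾ : ℤ → Poly → Poly
scaleᴾ a []      = []
scaleᴾ a (b ∷ q) = a * b ∷ scaleᴾ a q

_*ᴾ_ : Poly → Poly → Poly
p *ᴾ []      = []
p *ᴾ (b ∷ q) = scaleᴾ b p +ᴾ (+ 0 ∷ p *ᴾ q)

evalᴾ : ℤ → Poly → ℤ
evalᴾ t []      = + 0
evalᴾ t (a ∷ p) = a + t * evalᴾ t p

consTrimmed : ℤ → Poly → Poly
consTrimmed (+ zero) [] = []
consTrimmed a        p  = a ∷ p

trim : Poly → Poly
trim []      = []
trim (a ∷ p) = consTrimmed a (trim p)

evalᴾ-+ : ∀ t p q → evalᴾ t (p +ᴾ q) ≡ evalᴾ t p + evalᴾ t q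
evalᴾ-+ t []      q       = sym (ℤP.+-identityˡ _)
evalᴾ-+ t (a ∷ p) []      = sym (ℤP.+-identityʳ _)
evalᴾ-+ t (a ∷ p) (b ∷ q) =
  trans (cong (λ s → a + b + t * s) (evalᴾ-+ t p q)) (identity a b t (evalᴾ t p) (evalᴾ t q))
  where
  identity : ∀ a b t x y → a + b + t * (x + y) ≡ a + t * x + (b + t * y)
  identity = solve-∀

evalᴾ-scale : ∀ t a q → evalᴾ t (scaleᴾ a q) ≡ a * evalᴾ t q
evalᴾ-scale t a []      = sym (ℤP.*-zeroʳ a)
evalᴾ-scale t a (b ∷ q) = trans (cong (λ s → a * b + t * s) (evalᴾ-scale t a q)) (identity a b t (evalᴾ t q))
  where
  identity : ∀ a b t y → a * b + t * (a * y) ≡ a * (b + t * y)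
  identity = solve-∀

evalᴾ-* : ∀ t p q → evalᴾ t (p *ᴾ q) ≡ evalᴾ t p * evalᴾ t q
evalᴾ-* t p []      = sym (ℤP.*-zeroʳ (evalᴾ t p))
evalᴾ-* t p (b ∷ q) = begin
  evalᴾ t (scaleᴾ b p +ᴾ (+ 0 ∷ p *ᴾ q))            ≡⟨ evalᴾ-+ t (scaleᴾ b p) (+ 0 ∷ p *ᴾ q) ⟩
  evalᴾ t (scaleᴾ b p) + (+ 0 + t * evalᴾ t (p *ᴾ q))
                                                    ≡⟨ cong₂ (λ x y → x + (+ 0 + t * y)) (evalᴾ-scale t b p) (evalᴾ-* t p q) ⟩
  b * evalᴾ t p + (+ 0 + t * (evalᴾ t p * evalᴾ t q)) ≡⟨ identity b t (evalᴾ t p) (evalᴾ t q) ⟩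
  evalᴾ t p * (b + t * evalᴾ t q)                   ∎
  where
  identity : ∀ b t x y → b * x + (+ 0 + t * (x * y)) ≡ x * (b + t * y)
  identity = solve-∀

evalᴾ-trim : ∀ t p → evalᴾ t (trim p) ≡ evalᴾ t p
evalᴾ-trim t []      = refl
evalᴾ-trim t (a ∷ p) = trans (consTrimmed-eval a (trim p)) (cong (λ s → a + t * s) (evalᴾ-trim t p))
  where
  consTrimmed-eval : ∀ a p → evalᴾ t (consTrimmed a p) ≡ a + t * evalᴾ t p
  consTrimmed-eval (+ zero)  []      = +0≡+0+t*+0 t
  consTrimmed-eval (+ zero)  (b ∷ p) = refl
  consTrimmed-eval (+ suc n) p       = refl
  consTrimmed-eval -[1+ n ]  p       = refl

evalᴾ-trim-≡ : ∀ t p q → trim p ≡ trim q → evalᴾ t p ≡ evalᴾ t q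
evalᴾ-trim-≡ t p q p≈q = trans (sym (evalᴾ-trim t p)) (trans (cong (evalᴾ t) p≈q) (evalᴾ-trim t q))

module PolyMatrix = MatrixOps _+ᴾ_ _*ᴾ_ [] (+ 1 ∷ [])
open PolyMatrix using ()
  renaming (⟪_,_⟫ to ⟪_,_⟫ᴾ; _·_ to _·ᴾ_; _⊗_ to _⊗ᴾ_; tp to tpᴾ; scal to scalᴾ; interior to interiorᴾ; prod to prodᴾ)

evV : ℤ → V3 Poly → V3 ℤ
evV t = mapV (evalᴾ t)

evM : ℤ → M3 Poly → M3 ℤ
evM t = mapV (evV t)

infix 4 _≈ᴹ_

_≈ᴹ_ : M3 Poly → M3 Poly → Set
M ≈ᴹ M′ = mapV (mapV trim) M ≡ mapV (mapV trim) M′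

evM-≈ᴹ : ∀ t M M′ → M ≈ᴹ M′ → evM t M ≡ evM t M′
evM-≈ᴹ t M M′ M≈M′ =
  trans (sym (mapV-cong (mapV-cong (evalᴾ-trim t)) M))
        (trans (cong (evM t) M≈M′) (mapV-cong (mapV-cong (evalᴾ-trim t)) M′))

evalᴾ-⟪⟫ : ∀ t u v → evalᴾ t ⟪ u , v ⟫ᴾ ≡ ⟪ evV t u , evV t v ⟫
evalᴾ-⟪⟫ t ⟨ a₁ , a₂ , a₃ ⟩ ⟨ b₁ , b₂ , b₃ ⟩ =
  trans (evalᴾ-+ t (a₁ *ᴾ b₁ +ᴾ a₂ *ᴾ b₂) (a₃ *ᴾ b₃))
        (cong₂ _+_ (trans (evalᴾ-+ t (a₁ *ᴾ b₁) (a₂ *ᴾ b₂)) (cong₂ _+_ (evalᴾ-* t a₁ b₁) (evalᴾ-* t a₂ b₂)))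
                   (evalᴾ-* t a₃ b₃))

evV-· : ∀ t v M → evV t (v ·ᴾ M) ≡ evV t v · evM t M
evV-· t v M = cong₃ ⟨_,_,_⟩ (evalᴾ-⟪⟫ t v (mapV V3.e M)) (evalᴾ-⟪⟫ t v (mapV V3.x M)) (evalᴾ-⟪⟫ t v (mapV V3.q M))

evM-⊗ : ∀ t M M′ → evM t (M ⊗ᴾ M′) ≡ evM t M ⊗ evM t M′
evM-⊗ t M M′ = cong₃ ⟨_,_,_⟩ (evV-· t (V3.e M) M′) (evV-· t (V3.x M) M′) (evV-· t (V3.q M) M′)

evM-prod : ∀ t {L : Set} (F : L → M3 Poly) ls → evM t (prodᴾ F ls) ≡ prod (evM t ∘ F) ls
evM-prod t F []       = cong₃ ⟨_,_,_⟩ (cong₃ ⟨_,_,_⟩ one refl refl) (cong₃ ⟨_,_,_⟩ refl one refl) (cong₃ ⟨_,_,_⟩ refl refl one)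
  where
  one : evalᴾ t (+ 1 ∷ []) ≡ + 1
  one = cong (_+_ (+ 1)) (ℤP.*-zeroʳ t)
evM-prod t F (l ∷ ls) = trans (evM-⊗ t (F l) (prodᴾ F ls)) (cong (evM t (F l) ⊗_) (evM-prod t F ls))

valueᴾ : Maybe (ℤ × ℕ) → Poly
valueᴾ nothing        = []
valueᴾ (just (c , k)) = monomial k
  where
  monomial : ℕ → Poly
  monomial zero    = c ∷ []
  monomial (suc k) = + 0 ∷ monomial k

evalᴾ-valueᴾ : ∀ t m → evalᴾ t (valueᴾ m) ≡ valueAt t m
evalᴾ-valueᴾ t nothing        = refl
evalᴾ-valueᴾ t (just (c , k)) = go k
  where
  go : ∀ k → evalᴾ t (valueᴾ (just (c , k))) ≡ c * t ^ k
  go zero    = identity c t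
    where
    identity : ∀ c t → c + t * + 0 ≡ c * + 1
    identity = solve-∀
  go (suc k) = trans (cong (λ s → + 0 + t * s) (go k)) (identity c t (t ^ k))
    where
    identity : ∀ c t a → + 0 + t * (c * a) ≡ c * (t * a)
    identity = solve-∀

all-letters? : {P : Letter → Set} → (∀ l → Dec (P l)) → Dec (∀ l → P l)
all-letters? P? with P? A | P? X | P? B
... | yes pA | yes pX | yes pB = yes λ { A → pA ; X → pX ; B → pB }
... | no ¬pA | _      | _      = no λ all → ¬pA (all A)
... | _      | no ¬pX | _      = no λ all → ¬pX (all X)
... | _      | _      | no ¬pB = no λ all → ¬pB (all B)

long-words-undefined : ∀ l₄ ls a b c → dict (a ∷ b ∷ c ∷ l₄ ∷ ls) ≡ nothing
long-words-undefined l₄ ls = from-yes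
  (all-letters? λ a → all-letters? λ b → all-letters? λ c →
     MaybeP.≡-dec (ProductP.≡-dec _≟_ ℕ._≟_) (dict (a ∷ b ∷ c ∷ l₄ ∷ ls)) nothing)

const linear : ℤ → Poly
const k  = k ∷ []
linear k = + 0 ∷ k ∷ []

-- A weighted automaton on the states (e, x, q) whose walks from the
-- boundary back to the boundary reproduce the dictionary words with their
-- coefficients (and t^weight); e.g. AXA = (-1)·(-2t)·1.
transferᴾ : Letter → M3 Poly
transferᴾ X = ⟨ ⟨ const (+ 1) , const (+ 1) , [] ⟩ , ⟨ [] , [] , linear (- + 2) ⟩ , ⟨ [] , [] , [] ⟩ ⟩
transferᴾ A = ⟨ ⟨ [] , const (- + 1) , linear (+ 1) ⟩ , ⟨ linear (+ 1) , [] , linear (+ 1) ⟩ , ⟨ const (+ 1) , [] , [] ⟩ ⟩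
transferᴾ B = ⟨ ⟨ [] , [] , linear (- + 1) ⟩ , ⟨ [] , [] , linear (+ 1) ⟩ , ⟨ [] , [] , [] ⟩ ⟩

-- a symmetric intertwiner P (P N(l) = N(l)ᵀ P), its adjugate P′ and its
-- determinant d = -(t - 1)²
intertwinerᴾ adjugateᴾ : M3 Poly
intertwinerᴾ = ⟨ ⟨ const (+ 1) , const (+ 1) , linear (- + 2) ⟩
               , ⟨ const (+ 1) , const (+ 1) , - + 1 ∷ - + 1 ∷ [] ⟩
               , ⟨ linear (- + 2) , - + 1 ∷ - + 1 ∷ [] , + 0 ∷ + 3 ∷ + 1 ∷ [] ⟩ ⟩
adjugateᴾ = ⟨ ⟨ - + 1 ∷ + 1 ∷ [] , + 0 ∷ - + 1 ∷ + 1 ∷ [] , - + 1 ∷ + 1 ∷ [] ⟩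
            , ⟨ + 0 ∷ - + 1 ∷ + 1 ∷ [] , + 0 ∷ + 3 ∷ - + 3 ∷ [] , + 1 ∷ - + 1 ∷ [] ⟩
            , ⟨ - + 1 ∷ + 1 ∷ [] , + 1 ∷ - + 1 ∷ [] , [] ⟩ ⟩

determinantᴾ : Poly
determinantᴾ = - + 1 ∷ + 2 ∷ - + 1 ∷ []

intertwinesᴾ : ∀ l → intertwinerᴾ ⊗ᴾ transferᴾ l ≈ᴹ tpᴾ (transferᴾ l) ⊗ᴾ intertwinerᴾ
intertwinesᴾ X = refl
intertwinesᴾ A = refl
intertwinesᴾ B = refl

adjugateˡᴾ : adjugateᴾ ⊗ᴾ intertwinerᴾ ≈ᴹ scalᴾ determinantᴾ
adjugateˡᴾ = refl

adjugateʳᴾ : intertwinerᴾ ⊗ᴾ adjugateᴾ ≈ᴹ scalᴾ determinantᴾ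
adjugateʳᴾ = refl

readingᴾ : Letter → List Letter → Poly
readingᴾ c cs = V3.e (V3.e (transferᴾ c) ·ᴾ prodᴾ (interiorᴾ ∘ transferᴾ) cs)

Readsᴾ : Letter → List Letter → Set
Readsᴾ c cs = trim (readingᴾ c cs) ≡ trim (valueᴾ (dict (c ∷ cs)))

short-words-readᴾ : ∀ c a b → Readsᴾ c [] × Readsᴾ c (a ∷ []) × Readsᴾ c (a ∷ b ∷ [])
short-words-readᴾ = from-yes
  (all-letters? λ c → all-letters? λ a → all-letters? λ b →
     reads? c [] ×-dec reads? c (a ∷ []) ×-dec reads? c (a ∷ b ∷ []))
  where
  reads? : ∀ c cs → Dec (Readsᴾ c cs)
  reads? c cs = LP.≡-dec _≟_ _ _

transfer : ℤ → Letter → M3 ℤ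
transfer t l = evM t (transferᴾ l)

interior-strict : ∀ t l → IsStrict (interior (transfer t l))
interior-strict t X = _ , _ , _ , refl
interior-strict t A = _ , _ , _ , refl
interior-strict t B = _ , _ , _ , refl

reads-at : ∀ t c cs → Readsᴾ c cs →
           V3.e (V3.e (transfer t c) · prod (interior ∘ transfer t) cs) ≡ valueAt t (dict (c ∷ cs))
reads-at t c cs reads = begin
  V3.e (V3.e (transfer t c) · prod (interior ∘ transfer t) cs)
    ≡⟨ cong (λ Q → V3.e (V3.e (transfer t c) · Q)) (sym (evM-prod t (interiorᴾ ∘ transferᴾ) cs)) ⟩
  V3.e (evV t (V3.e (transferᴾ c)) · evM t (prodᴾ (interiorᴾ ∘ transferᴾ) cs))
    ≡⟨ cong V3.e (sym (evV-· t (V3.e (transferᴾ c)) (prodᴾ (interiorᴾ ∘ transferᴾ) cs))) ⟩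
  evalᴾ t (readingᴾ c cs)
    ≡⟨ evalᴾ-trim-≡ t (readingᴾ c cs) (valueᴾ (dict (c ∷ cs))) reads ⟩
  evalᴾ t (valueᴾ (dict (c ∷ cs)))
    ≡⟨ evalᴾ-valueᴾ t (dict (c ∷ cs)) ⟩
  valueAt t (dict (c ∷ cs)) ∎

-- The automaton of the transfer matrices reads off the dictionary: words
-- of at most three letters are checked, longer ones are killed by the
-- nilpotent interior matrices.
recognizes : ∀ t c cs → V3.e (V3.e (transfer t c) · prod (interior ∘ transfer t) cs) ≡ valueAt t (dict (c ∷ cs))
recognizes t c []               = reads-at t c [] (proj₁ (short-words-readᴾ c c c))
recognizes t c (a ∷ [])         = reads-at t c (a ∷ []) (proj₁ (proj₂ (short-words-readᴾ c a a)))
recognizes t c (a ∷ b ∷ [])     = reads-at t c (a ∷ b ∷ []) (proj₂ (proj₂ (short-words-readᴾ c a b)))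
recognizes t c (a ∷ b ∷ d ∷ ls) = begin
  V3.e (V3.e (transfer t c) · prod (interior ∘ transfer t) (a ∷ b ∷ d ∷ ls))
    ≡⟨ cong (λ Q → V3.e (V3.e (transfer t c) · Q)) (prod-nilpotent (interior ∘ transfer t) (interior-strict t) a b d ls) ⟩
  V3.e (V3.e (transfer t c) · O)
    ≡⟨ boundary-·-O (V3.e (transfer t c)) ⟩
  + 0
    ≡⟨ cong (valueAt t) (sym (long-words-undefined d ls c a b)) ⟩
  valueAt t (dict (c ∷ a ∷ b ∷ d ∷ ls)) ∎

module Transfer (t : ℤ) =
  ParsingsAsTrace t (transfer t) (recognizes t) (prod-traceless (interior ∘ transfer t) (interior-strict t))

intertwines : ∀ t l → evM t intertwinerᴾ ⊗ transfer t l ≡ tp (transfer t l) ⊗ evM t intertwinerᴾ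
intertwines t l = begin
  evM t intertwinerᴾ ⊗ transfer t l          ≡⟨ sym (evM-⊗ t intertwinerᴾ (transferᴾ l)) ⟩
  evM t (intertwinerᴾ ⊗ᴾ transferᴾ l)         ≡⟨ evM-≈ᴹ t (intertwinerᴾ ⊗ᴾ transferᴾ l) (tpᴾ (transferᴾ l) ⊗ᴾ intertwinerᴾ) (intertwinesᴾ l) ⟩
  evM t (tpᴾ (transferᴾ l) ⊗ᴾ intertwinerᴾ)   ≡⟨ evM-⊗ t (tpᴾ (transferᴾ l)) intertwinerᴾ ⟩
  tp (transfer t l) ⊗ evM t intertwinerᴾ      ∎

adjugateˡ : ∀ t → evM t adjugateᴾ ⊗ evM t intertwinerᴾ ≡ scal (evalᴾ t determinantᴾ)
adjugateˡ t = trans (sym (evM-⊗ t adjugateᴾ intertwinerᴾ)) (evM-≈ᴹ t (adjugateᴾ ⊗ᴾ intertwinerᴾ) (scalᴾ determinantᴾ) adjugateˡᴾ)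

adjugateʳ : ∀ t → evM t intertwinerᴾ ⊗ evM t adjugateᴾ ≡ scal (evalᴾ t determinantᴾ)
adjugateʳ t = trans (sym (evM-⊗ t intertwinerᴾ adjugateᴾ)) (evM-≈ᴹ t (intertwinerᴾ ⊗ᴾ adjugateᴾ) (scalᴾ determinantᴾ) adjugateʳᴾ)

-- d(1 + s) = -s², which is nonzero for s ≥ 1
determinant-cancel : ∀ n {x y} → evalᴾ (+ suc (suc n)) determinantᴾ * x ≡ evalᴾ (+ suc (suc n)) determinantᴾ * y → x ≡ y
determinant-cancel n {x} {y} dx≡dy =
  ℤP.*-cancelˡ-≡ (- (+ suc n * + suc n)) x y (subst (λ d → d * x ≡ d * y) (determinant-at (+ suc n)) dx≡dy)
  where
  determinant-at : ∀ s → - + 1 + (+ 1 + s) * (+ 2 + (+ 1 + s) * (- + 1 + (+ 1 + s) * + 0)) ≡ - (s * s)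
  determinant-at = solve-∀

trace-reverse : ∀ n ls → tr (prod (transfer (+ suc (suc n))) ls) ≡ tr (prod (transfer (+ suc (suc n))) (List.reverse ls))
trace-reverse n ls = determinant-cancel n
  (trace-reversal (transfer T) (evM T intertwinerᴾ) (evM T adjugateᴾ) (evalᴾ T determinantᴾ)
                  (intertwines T) (adjugateˡ T) (adjugateʳ T) ls)
  where
  T = + suc (suc n)

parsings : List Letter → List (Maybe (ℤ × ℕ))
parsings s = map (parsing s) (cutPatterns (length s))

coeffL≡coefficient : ∀ s w → coeffL s w ≡ coefficient w (parsings s)
coeffL≡coefficient s w = sym (sumOver-map (parsing s) (cutPatterns (length s)) (contrib w))

evaluation≡trace : ∀ t c cs → evaluation t (parsings (c ∷ cs)) ≡ tr (prod (transfer t) (c ∷ cs))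
evaluation≡trace t c cs =
  trans (sumOver-map (parsing (c ∷ cs)) (cutPatterns (length (c ∷ cs))) (valueAt t)) (Transfer.trace-formula t c cs)

reverse-∷ : ∀ (c : Letter) cs → ∃₂ λ c′ cs′ → List.reverse (c ∷ cs) ≡ c′ ∷ cs′
reverse-∷ c cs with List.reverse cs | LP.unfold-reverse c cs
... | []       | rev≡ = c , [] , rev≡
... | c′ ∷ cs′ | rev≡ = c′ , cs′ ++ c ∷ [] , rev≡

-- Reversal symmetry for words: for t ≥ 2 both evaluations are traces of
-- products which agree by trace reversal, hence so do all coefficients.
coeffL-reverse : ∀ s w → coeffL s w ≡ coeffL (List.reverse s) w
coeffL-reverse []       w = refl
coeffL-reverse (c ∷ cs) w with reverse-∷ c cs
... | c′ , cs′ , rev≡ = begin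
  coeffL s w                                  ≡⟨ coeffL≡coefficient s w ⟩
  coefficient w (parsings s)                  ≡⟨ coefficients-agree w (parsings s) (parsings (List.reverse s))
                                                                    evaluations-agree ⟩
  coefficient w (parsings (List.reverse s))   ≡⟨ sym (coeffL≡coefficient (List.reverse s) w) ⟩
  coeffL (List.reverse s) w                   ∎
  where
  s = c ∷ cs
  evaluations-agree : ∀ n → evaluation (+ suc (suc n)) (parsings s) ≡ evaluation (+ suc (suc n)) (parsings (List.reverse s))
  evaluations-agree n = begin
    evaluation T (parsings s)                  ≡⟨ evaluation≡trace T c cs ⟩
    tr (prod (transfer T) s)                   ≡⟨ trace-reverse n s ⟩
    tr (prod (transfer T) (List.reverse s))    ≡⟨ cong (tr ∘ prod (transfer T)) rev≡ ⟩
    tr (prod (transfer T) (c′ ∷ cs′))          ≡⟨ sym (evaluation≡trace T c′ cs′) ⟩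
    evaluation T (parsings (c′ ∷ cs′))         ≡⟨ cong (evaluation T ∘ parsings) (sym rev≡) ⟩
    evaluation T (parsings (List.reverse s))   ∎
    where
    T = + suc (suc n)

-- Theorem 4.1: |S| = |reverse S|, coefficientwise (the Vec reversal of a
-- representative is the list reversal).
theorem4p1 : (N : ℕ) → N ≥ 1 → (S : Vec Letter N) →
    ∀ (w : ℕ) → coeff S w ≡ coeff (reverse S) w
theorem4p1 _ _ S w = trans (coeffL-reverse (toList S) w) (cong (λ s → coeffL s w) (sym (VP.toList-reverse S)))
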